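{- Let $p$ be an odd prime, $d$ and $t$ positive integers with $p^t\equiv-1\pmod{2d}$, $q=p^{4t}$, $g$ a primitive root of $\mathbb{F}_q$, and $C_0=\langle g^{2d}\rangle$. Let $x\in C_0$. If $\{x,x^{p^{2t}}\}$ is linearly dependent over $\mathbb{F}_{p^t}$, then $x\in\langle g^{(p^{2t}+1)d}\rangle$.
   Context: $\langle h\rangle$ denotes the cyclic subgroup of $\mathbb{F}_q^*$ generated by $h$. -}

module Defs where

open import Level using (Level; _⊔_)
open import Algebra.Bundles using (CommutativeRing)
open import Data.Nat using (ℕ; zero; suc)
open import Data.Fin.Properties using (≡-setoid)
open import Data.Product using (Σ; ∃; _×_)
open import Function.Bundles using (Bijection)
open import Relation.Nullary using (¬_)

module FieldDefs {c ℓ : Level} (F : CommutativeRing c ℓ) where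
  open CommutativeRing F

  IsField : Set (c ⊔ ℓ)
  IsField = (¬ (1# ≈ 0#)) × (∀ x → ¬ (x ≈ 0#) → ∃ λ y → x * y ≈ 1#)

  HasCard : ℕ → Set (c ⊔ ℓ)
  HasCard n = Bijection setoid (≡-setoid n)

  pow : Carrier → ℕ → Carrier
  pow x zero    = 1#
  pow x (suc n) = x * pow x n

  _∈⟨_⟩ : Carrier → Carrier → Set ℓ
  y ∈⟨ h ⟩ = ∃ λ (k : ℕ) → y ≈ pow h k

  IsPrimitiveRoot : Carrier → Set (c ⊔ ℓ)
  IsPrimitiveRoot g = (¬ (g ≈ 0#)) × (∀ y → ¬ (y ≈ 0#) → y ∈⟨ g ⟩)

  -- the subfield of order m inside F, i.e. {y | y^m = y}
  InSubfield : ℕ → Carrier → Set ℓ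
  InSubfield m y = pow y m ≈ y

  LinDep : ℕ → Carrier → Carrier → Set (c ⊔ ℓ)
  LinDep m x y = ∃ λ a → ∃ λ b →
    InSubfield m a × InSubfield m b × (¬ (a ≈ 0# × b ≈ 0#)) × (a * x + b * y ≈ 0#)

{-# OPTIONS --safe #-}
module Submission where

-- Write p^t = P = 1 + 2R and Q = P² = p^{2t}.  From a x + b x^Q = 0 with a, b ∈ F_P not both
-- zero we get b x^Q = -(a x); raising this to the odd power P, which fixes a and b, gives
-- b x^{QP} = -(a x^P), and multiplying the two relations and cancelling ab leaves
-- x^{1+QP} = x^{Q+P}, i.e. x^{(Q-1)(P-1)} = 1.  As g has order q - 1 = (Q - 1)(Q + 1),
-- writing x = g^{2dk} yields (Q + 1)/2 ∣ (P - 1) d k.  But (Q + 1)/2 = 2R(R + 1) + 1 is coprime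
-- to P - 1 = 2R and to d ∣ R + 1, so (Q + 1)/2 ∣ k, and then x = g^{2dk} is a power of
-- g^{(Q+1)d}.

open import Defs
open import Level using (Level)
open import Algebra.Bundles using (CommutativeRing)
open import Data.Nat as ℕ using (ℕ; zero; suc; NonZero; >-nonZero; nonTrivial⇒n>1; _%_; _/_; _∸_; _≤_; _<_)
import Data.Nat.Properties as ℕₚ
open import Data.Nat.Properties using (≤-antisym; ≤-trans; <⇒≱; <⇒≤; <-irrefl; n<1+n; ≤-pred; m<n⇒0<n∸m; m∸n≤m; m+[n∸m]≡n; *-suc; ^-monoʳ-<; m*n≢0)
open import Data.Nat.DivMod using (m≡m%n+[m/n]*n; m%n<n)
open import Data.Nat.Divisibility using (_∣_; _∣0; ∣-trans; m∣m*n; n∣m*n; ∣m∣n⇒∣m+n; ∣m+n∣m⇒∣n; ∣1⇒≡1; *-cancelˡ-∣; m%n≡0⇒n∣m)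
open import Data.Nat.Coprimality using (Coprime; coprime-divisor)
open import Data.Nat.Primality using (Prime; prime[2]; euclidsLemma; prime⇒nonTrivial)
open import Data.Nat.Tactic.RingSolver using (solve-∀)
open import Data.Fin using (Fin; toℕ; fromℕ<; punchIn; punchOut)
open import Data.Fin.Properties using (pigeonhole; injective⇒≤; punchOut-injective; punchIn-injective; punchInᵢ≢i; toℕ<n; toℕ-fromℕ<)
open import Data.Product using (∃-syntax; _×_; _,_; proj₁; proj₂; uncurry)
open import Data.Sum using (inj₁; inj₂)
open import Function.Bundles using (Bijection; Surjection)
open import Relation.Nullary using (¬_; contradiction)
import Relation.Binary.PropositionalEquality as ≡
open ≡ using (_≡_)

module FieldProperties {c ℓ : Level} (F : CommutativeRing c ℓ) (isField : FieldDefs.IsField F) where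
  open CommutativeRing F
  open FieldDefs F
  import Algebra.Properties.Semiring.Exp semiring as Exp
  open import Algebra.Properties.CommutativeSemiring.Exp commutativeSemiring using (^-distrib-*)
  open import Algebra.Properties.Ring ring using (-‿distribʳ-*; -‿distribˡ-*)
  open import Algebra.Properties.Group +-group using (⁻¹-involutive; inverseʳ-unique; ε⁻¹≈ε)
  open import Algebra.Properties.CommutativeSemigroup *-commutativeSemigroup using (interchange)
  open import Relation.Binary.Reasoning.Setoid setoid

  pow≡^ : ∀ x n → pow x n ≡.≡ x Exp.^ n
  pow≡^ x zero    = ≡.refl
  pow≡^ x (suc n) = ≡.cong (x *_) (pow≡^ x n)

  pow-congˡ : ∀ {x y} n → x ≈ y → pow x n ≈ pow y n
  pow-congˡ {x} {y} n x≈y rewrite pow≡^ x n | pow≡^ y n = Exp.^-congˡ n x≈y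

  pow-homo-+ : ∀ x m n → pow x (m ℕ.+ n) ≈ pow x m * pow x n
  pow-homo-+ x m n rewrite pow≡^ x (m ℕ.+ n) | pow≡^ x m | pow≡^ x n = Exp.^-homo-* x m n

  pow-assocʳ : ∀ x m n → pow (pow x m) n ≈ pow x (m ℕ.* n)
  pow-assocʳ x m n rewrite pow≡^ (pow x m) n | pow≡^ x m | pow≡^ x (m ℕ.* n) = Exp.^-assocʳ x m n

  pow-distrib-* : ∀ x y n → pow (x * y) n ≈ pow x n * pow y n
  pow-distrib-* x y n rewrite pow≡^ (x * y) n | pow≡^ x n | pow≡^ y n = ^-distrib-* x y n

  pow-1# : ∀ n → pow 1# n ≈ 1#
  pow-1# zero    = refl
  pow-1# (suc n) = trans (*-identityˡ _) (pow-1# n)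

  -x*-y≈x*y : ∀ x y → - x * - y ≈ x * y
  -x*-y≈x*y x y = begin
    - x * - y     ≈⟨ -‿distribˡ-* x (- y) ⟨
    - (x * - y)   ≈⟨ -‿cong (-‿distribʳ-* x y) ⟨
    - - (x * y)   ≈⟨ ⁻¹-involutive (x * y) ⟩
    x * y         ∎

  pow-neg-odd : ∀ r x → pow (- x) (suc (2 ℕ.* r)) ≈ - pow x (suc (2 ℕ.* r))
  pow-neg-odd r x = begin
    - x * pow (- x) (2 ℕ.* r)       ≈⟨ *-congˡ (pow-assocʳ (- x) 2 r) ⟨
    - x * pow (pow (- x) 2) r       ≈⟨ *-congˡ (pow-congˡ r square-neg) ⟩
    - x * pow (pow x 2) r           ≈⟨ *-congˡ (pow-assocʳ x 2 r) ⟩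
    - x * pow x (2 ℕ.* r)           ≈⟨ -‿distribˡ-* x _ ⟨
    - (x * pow x (2 ℕ.* r))         ∎
    where
    square-neg : pow (- x) 2 ≈ pow x 2
    square-neg = begin
      - x * (- x * 1#)  ≈⟨ *-congˡ (*-identityʳ (- x)) ⟩
      - x * - x         ≈⟨ -x*-y≈x*y x x ⟩
      x * x             ≈⟨ *-congˡ (*-identityʳ x) ⟨
      x * (x * 1#)      ∎

  *-cancelˡ : ∀ {x y z} → x ≉ 0# → x * y ≈ x * z → y ≈ z
  *-cancelˡ {x} {y} {z} x≉0 xy≈xz with proj₂ isField x x≉0
  ... | x⁻¹ , x*x⁻¹≈1 = begin
      y               ≈⟨ divide y ⟨
      x⁻¹ * (x * y)   ≈⟨ *-congˡ xy≈xz ⟩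
      x⁻¹ * (x * z)   ≈⟨ divide z ⟩
      z               ∎
    where
    divide : ∀ w → x⁻¹ * (x * w) ≈ w
    divide w = begin
      x⁻¹ * (x * w)   ≈⟨ *-assoc x⁻¹ x w ⟨
      x⁻¹ * x * w     ≈⟨ *-congʳ (trans (*-comm x⁻¹ x) x*x⁻¹≈1) ⟩
      1# * w          ≈⟨ *-identityˡ w ⟩
      w               ∎

  *-cancelʳ : ∀ {x y z} → x ≉ 0# → y * x ≈ z * x → y ≈ z
  *-cancelʳ {x} {y} {z} x≉0 yx≈zx = *-cancelˡ x≉0 (trans (*-comm x y) (trans yx≈zx (*-comm z x)))

  *≈0⇒≈0 : ∀ {x y} → x ≉ 0# → y * x ≈ 0# → y ≈ 0#
  *≈0⇒≈0 {x} x≉0 yx≈0 = *-cancelʳ x≉0 (trans yx≈0 (sym (zeroˡ x)))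

  *-≉0 : ∀ {x y} → x ≉ 0# → y ≉ 0# → x * y ≉ 0#
  *-≉0 x≉0 y≉0 xy≈0 = y≉0 (*-cancelˡ x≉0 (trans xy≈0 (sym (zeroʳ _))))

  pow-≉0 : ∀ {x} → x ≉ 0# → ∀ n → pow x n ≉ 0#
  pow-≉0 x≉0 zero    = proj₁ isField
  pow-≉0 x≉0 (suc n) = *-≉0 x≉0 (pow-≉0 x≉0 n)

  pow-+-cancel : ∀ {x} m n → x ≉ 0# → pow x (m ℕ.+ n) ≈ pow x m → pow x n ≈ 1#
  pow-+-cancel {x} m n x≉0 x^[m+n]≈x^m = *-cancelˡ (pow-≉0 x≉0 m) (begin
    pow x m * pow x n   ≈⟨ pow-homo-+ x m n ⟨
    pow x (m ℕ.+ n)     ≈⟨ x^[m+n]≈x^m ⟩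
    pow x m             ≈⟨ *-identityʳ (pow x m) ⟨
    pow x m * 1#        ∎)

  linear-relation-coefficients≉0 : ∀ {a b x y} → x ≉ 0# → y ≉ 0# → ¬ (a ≈ 0# × b ≈ 0#) →
                                   a * x + b * y ≈ 0# → a ≉ 0# × b ≉ 0#
  linear-relation-coefficients≉0 {a} {b} {x} {y} x≉0 y≉0 ¬a≈0×b≈0 rel =
    (λ a≈0 → ¬a≈0×b≈0 (a≈0 , *≈0⇒≈0 y≉0 (by≈0 a≈0))) ,
    (λ b≈0 → ¬a≈0×b≈0 (*≈0⇒≈0 x≉0 (ax≈0 b≈0) , b≈0))
    where
    by≈0 : a ≈ 0# → b * y ≈ 0#
    by≈0 a≈0 = begin
      b * y         ≈⟨ inverseʳ-unique (a * x) (b * y) rel ⟩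
      - (a * x)     ≈⟨ -‿cong (trans (*-congʳ a≈0) (zeroˡ x)) ⟩
      - 0#          ≈⟨ ε⁻¹≈ε ⟩
      0#            ∎
    ax≈0 : b ≈ 0# → a * x ≈ 0#
    ax≈0 b≈0 = begin
      a * x             ≈⟨ +-identityʳ (a * x) ⟨
      a * x + 0#        ≈⟨ +-congˡ (trans (*-congʳ b≈0) (zeroˡ y)) ⟨
      a * x + b * y     ≈⟨ rel ⟩
      0#                ∎

  module _ (r : ℕ) where

    private
      P : ℕ
      P = suc (2 ℕ.* r)

    pow-odd-relation : ∀ {a b x y} → InSubfield P a → InSubfield P b →
                       b * y ≈ - (a * x) → b * pow y P ≈ - (a * pow x P)
    pow-odd-relation {a} {b} {x} {y} a^P≈a b^P≈b by≈-ax = begin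
      b * pow y P               ≈⟨ *-congʳ b^P≈b ⟨
      pow b P * pow y P         ≈⟨ pow-distrib-* b y P ⟨
      pow (b * y) P             ≈⟨ pow-congˡ P by≈-ax ⟩
      pow (- (a * x)) P         ≈⟨ pow-neg-odd r (a * x) ⟩
      - pow (a * x) P           ≈⟨ -‿cong (pow-distrib-* a x P) ⟩
      - (pow a P * pow x P)     ≈⟨ -‿cong (*-congʳ a^P≈a) ⟩
      - (a * pow x P)           ∎

    linDep⇒pow[1+QP]≈pow[Q+P] : ∀ {x} Q → x ≉ 0# → LinDep P x (pow x Q) →
                                pow x (1 ℕ.+ Q ℕ.* P) ≈ pow x (Q ℕ.+ P)
    linDep⇒pow[1+QP]≈pow[Q+P] {x} Q x≉0 (a , b , a^P≈a , b^P≈b , ¬a≈0×b≈0 , rel) =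
      begin
        x * pow x (Q ℕ.* P)         ≈⟨ *-congˡ (pow-assocʳ x Q P) ⟨
        x * pow y P                 ≈⟨ *-cancelˡ (uncurry *-≉0 a≉0×b≉0) ab[x*y^P]≈ab[y*x^P] ⟩
        y * pow x P                 ≈⟨ pow-homo-+ x Q P ⟨
        pow x (Q ℕ.+ P)             ∎
      where
      y : Carrier
      y = pow x Q
      by≈-ax : b * y ≈ - (a * x)
      by≈-ax = inverseʳ-unique (a * x) (b * y) rel
      a≉0×b≉0 : a ≉ 0# × b ≉ 0#
      a≉0×b≉0 = linear-relation-coefficients≉0 x≉0 (pow-≉0 x≉0 Q) ¬a≈0×b≈0 rel
      ab[x*y^P]≈ab[y*x^P] : a * b * (x * pow y P) ≈ a * b * (y * pow x P)
      ab[x*y^P]≈ab[y*x^P] = begin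
        a * b * (x * pow y P)       ≈⟨ interchange a b x (pow y P) ⟩
        a * x * (b * pow y P)       ≈⟨ *-congˡ (pow-odd-relation a^P≈a b^P≈b by≈-ax) ⟩
        a * x * - (a * pow x P)     ≈⟨ -‿distribʳ-* (a * x) _ ⟨
        - (a * x * (a * pow x P))   ≈⟨ -‿distribˡ-* (a * x) _ ⟩
        - (a * x) * (a * pow x P)   ≈⟨ *-congʳ by≈-ax ⟨
        b * y * (a * pow x P)       ≈⟨ interchange b y a (pow x P) ⟩
        b * a * (y * pow x P)       ≈⟨ *-congʳ (*-comm b a) ⟩
        a * b * (y * pow x P)       ∎

  pow-mod : ∀ {x} e .{{_ : NonZero e}} → pow x e ≈ 1# → ∀ m → pow x m ≈ pow x (m % e)
  pow-mod {x} e x^e≈1 m = begin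
    pow x m                               ≡⟨ ≡.cong (pow x) (m≡m%n+[m/n]*n m e) ⟩
    pow x (m % e ℕ.+ m / e ℕ.* e)         ≈⟨ pow-homo-+ x (m % e) (m / e ℕ.* e) ⟩
    pow x (m % e) * pow x (m / e ℕ.* e)   ≈⟨ *-congˡ (x^[q*e]≈1 (m / e)) ⟩
    pow x (m % e) * 1#                    ≈⟨ *-identityʳ _ ⟩
    pow x (m % e)                         ∎
    where
    x^[q*e]≈1 : ∀ q → pow x (q ℕ.* e) ≈ 1#
    x^[q*e]≈1 q = begin
      pow x (q ℕ.* e)       ≡⟨ ≡.cong (pow x) (ℕₚ.*-comm q e) ⟩
      pow x (e ℕ.* q)       ≈⟨ pow-assocʳ x e q ⟨
      pow (pow x e) q       ≈⟨ pow-congˡ q x^e≈1 ⟩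
      pow 1# q              ≈⟨ pow-1# q ⟩
      1#                    ∎

  minimal-period-∣ : ∀ {x} e .{{_ : NonZero e}} → pow x e ≈ 1# →
                     (∀ k .{{_ : NonZero k}} → pow x k ≈ 1# → e ≤ k) →
                     ∀ m → pow x m ≈ 1# → e ∣ m
  minimal-period-∣ {x} e x^e≈1 minimal m x^m≈1 with m % e in m%e≡r
  ... | zero  = m%n≡0⇒n∣m m e m%e≡r
  ... | suc r = contradiction (minimal (suc r) x^[r+1]≈1) (<⇒≱ (≡.subst (_< e) m%e≡r (m%n<n m e)))
    where
    x^[r+1]≈1 : pow x (suc r) ≈ 1#
    x^[r+1]≈1 = begin
      pow x (suc r)   ≡⟨ ≡.cong (pow x) m%e≡r ⟨
      pow x (m % e)   ≈⟨ pow-mod e x^e≈1 m ⟨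
      pow x m         ≈⟨ x^m≈1 ⟩
      1#              ∎

  module PrimitiveRoot {n : ℕ} (card : HasCard (suc n)) {g : Carrier} (g-primitive : IsPrimitiveRoot g) where
    open Bijection card using (to; injective) renaming (cong to to-cong)
    open Surjection (Bijection.surjection card) using (to⁻; to∘to⁻)

    private
      g≉0 : g ≉ 0#
      g≉0 = proj₁ g-primitive

    -- The nonzero elements are enumerated by Fin n, punching out the index of 0#.
    nonzero : Fin n → Carrier
    nonzero a = to⁻ (punchIn (to 0#) a)

    to-nonzero : ∀ a → to (nonzero a) ≡.≡ punchIn (to 0#) a
    to-nonzero a = to∘to⁻ (punchIn (to 0#) a)

    nonzero≉0 : ∀ a → nonzero a ≉ 0#
    nonzero≉0 a a≈0 = punchInᵢ≢i (to 0#) a (≡.trans (≡.sym (to-nonzero a)) (to-cong a≈0))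

    nonzero-injective : ∀ {a b} → nonzero a ≈ nonzero b → a ≡.≡ b
    nonzero-injective {a} {b} a≈b =
      punchIn-injective (to 0#) a b (≡.trans (≡.sym (to-nonzero a)) (≡.trans (to-cong a≈b) (to-nonzero b)))

    log : Fin n → ℕ
    log a = proj₁ (proj₂ g-primitive (nonzero a) (nonzero≉0 a))

    nonzero≈pow-log : ∀ a → nonzero a ≈ pow g (log a)
    nonzero≈pow-log a = proj₂ (proj₂ g-primitive (nonzero a) (nonzero≉0 a))

    to-pow≢to-0 : ∀ k → to 0# ≡.≢ to (pow g k)
    to-pow≢to-0 k eq = pow-≉0 g≉0 k (sym (injective eq))

    pow-index : Fin (suc n) → Fin n
    pow-index k = punchOut (to-pow≢to-0 (toℕ k))

    -- Reducing discrete logarithms modulo a period e separates the n nonzero elements.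
    n≤period : ∀ e .{{_ : NonZero e}} → pow g e ≈ 1# → n ≤ e
    n≤period e g^e≈1 = injective⇒≤ log-mod-injective
      where
      log-mod : Fin n → Fin e
      log-mod a = fromℕ< (m%n<n (log a) e)
      log-mod-injective : ∀ {a b} → log-mod a ≡.≡ log-mod b → a ≡.≡ b
      log-mod-injective {a} {b} eq = nonzero-injective (begin
        nonzero a             ≈⟨ nonzero≈pow-log a ⟩
        pow g (log a)         ≈⟨ pow-mod e g^e≈1 (log a) ⟩
        pow g (log a % e)     ≡⟨ ≡.cong (pow g) log-a%e≡log-b%e ⟩
        pow g (log b % e)     ≈⟨ pow-mod e g^e≈1 (log b) ⟨
        pow g (log b)         ≈⟨ nonzero≈pow-log b ⟨
        nonzero b             ∎)
        where
        log-a%e≡log-b%e : log a % e ≡.≡ log b % e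
        log-a%e≡log-b%e = ≡.trans (≡.sym (toℕ-fromℕ< (m%n<n (log a) e)))
                            (≡.trans (≡.cong toℕ eq) (toℕ-fromℕ< (m%n<n (log b) e)))

    period-exists : ∃[ e ] NonZero e × e ≤ n × pow g e ≈ 1#
    period-exists with pigeonhole (n<1+n n) pow-index
    ... | i , j , i<j , index-i≡index-j = toℕ j ∸ toℕ i , >-nonZero (m<n⇒0<n∸m i<j) , j-i≤n , g^[j-i]≈1
      where
      j-i≤n : toℕ j ∸ toℕ i ≤ n
      j-i≤n = ≤-trans (m∸n≤m (toℕ j) (toℕ i)) (≤-pred (toℕ<n j))
      g^i≈g^j : pow g (toℕ i) ≈ pow g (toℕ j)
      g^i≈g^j = injective (punchOut-injective (to-pow≢to-0 (toℕ i)) (to-pow≢to-0 (toℕ j)) index-i≡index-j)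
      g^[j-i]≈1 : pow g (toℕ j ∸ toℕ i) ≈ 1#
      g^[j-i]≈1 = pow-+-cancel (toℕ i) (toℕ j ∸ toℕ i) g≉0 (begin
        pow g (toℕ i ℕ.+ (toℕ j ∸ toℕ i))   ≡⟨ ≡.cong (pow g) (m+[n∸m]≡n (<⇒≤ i<j)) ⟩
        pow g (toℕ j)                       ≈⟨ g^i≈g^j ⟨
        pow g (toℕ i)                       ∎)

    order-∣ : ∀ m → pow g m ≈ 1# → n ∣ m
    order-∣ m g^m≈1 with period-exists
    ... | e , e≢0 , e≤n , g^e≈1 = ≡.subst (_∣ m) e≡n
          (minimal-period-∣ e {{e≢0}} g^e≈1 (λ k g^k≈1 → ≤-trans e≤n (n≤period k g^k≈1)) m g^m≈1)
      where
      e≡n : e ≡.≡ n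
      e≡n = ≤-antisym e≤n (n≤period e {{e≢0}} g^e≈1)

-- Opened only now, since FieldProperties uses the ring's _+_ and _*_.
open import Data.Nat using (_+_; _*_; _^_; _≥_)

coprime-+1 : ∀ {m c} → c ∣ m → Coprime (m + 1) c
coprime-+1 c∣m (e∣m+1 , e∣c) = ∣1⇒≡1 (∣m+n∣m⇒∣n e∣m+1 (∣-trans e∣c c∣m))

odd⇒suc-double : ∀ {m} → ¬ 2 ∣ m → ∃[ r ] m ≡ suc (2 * r)
odd⇒suc-double {0} ¬2∣m = contradiction (2 ∣0) ¬2∣m
odd⇒suc-double {1} ¬2∣m = 0 , ≡.refl
odd⇒suc-double {suc (suc m)} ¬2∣m with odd⇒suc-double {m} (λ 2∣m → ¬2∣m (∣m∣n⇒∣m+n (m∣m*n 1) 2∣m))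
... | r , ≡.refl = suc r , ≡.cong suc (≡.sym (*-suc 2 r))

odd-pow : ∀ {p} → ¬ 2 ∣ p → ∀ n → ¬ 2 ∣ p ^ n
odd-pow ¬2∣p zero 2∣1 = contradiction (∣1⇒≡1 2∣1) λ ()
odd-pow {p} ¬2∣p (suc n) 2∣p^n+1 with euclidsLemma p (p ^ n) prime[2] 2∣p^n+1
... | inj₁ 2∣p   = ¬2∣p 2∣p
... | inj₂ 2∣p^n = odd-pow ¬2∣p n 2∣p^n

odd-prime-power : ∀ {p t} → Prime p → ¬ 2 ∣ p → t ≥ 1 → ∃[ R ] NonZero R × p ^ t ≡ suc (2 * R)
odd-prime-power {p} {t} prime-p ¬2∣p t≥1 with odd⇒suc-double (odd-pow ¬2∣p t)
... | suc r , p^t≡ = suc r , _ , p^t≡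
... | zero  , p^t≡1 = contradiction 1<p^t (<-irrefl (≡.sym p^t≡1))
  where
  1<p^t : 1 < p ^ t
  1<p^t = ^-monoʳ-< p (nonTrivial⇒n>1 p {{prime⇒nonTrivial prime-p}}) t≥1

-- Quantities attached to the odd number P = 1 + 2R, written without ℕ subtraction or division.
-- The identities below are proved for the unfolded polynomials in R, which the ring solver
-- needs since it treats defined names as opaque constants.
module OddNumber (R : ℕ) where

  P : ℕ
  P = suc (2 * R)

  P-1 : ℕ
  P-1 = 2 * R

  P² : ℕ
  P² = P * P

  P²-1 : ℕ
  P²-1 = (2 + 2 * R) * (2 * R)

  [P²+1]/2 : ℕ
  [P²+1]/2 = 2 * R * suc R + 1

  P⁴-1 : ℕ
  P⁴-1 = P²-1 * (2 * [P²+1]/2)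

  P⁴≡1+P⁴-1 : P² * P² ≡ 1 + P⁴-1
  P⁴≡1+P⁴-1 = identity R
    where
    identity : ∀ R → suc (2 * R) * suc (2 * R) * (suc (2 * R) * suc (2 * R)) ≡
                     1 + (2 + 2 * R) * (2 * R) * (2 * (2 * R * suc R + 1))
    identity = solve-∀

  1+P²*P≡P²+P+[P²-1]*[P-1] : 1 + P² * P ≡ P² + P + P²-1 * P-1
  1+P²*P≡P²+P+[P²-1]*[P-1] = identity R
    where
    identity : ∀ R → 1 + suc (2 * R) * suc (2 * R) * suc (2 * R) ≡
                     suc (2 * R) * suc (2 * R) + suc (2 * R) + (2 + 2 * R) * (2 * R) * (2 * R)
    identity = solve-∀

  P+1≡2*[R+1] : P + 1 ≡ 2 * suc R
  P+1≡2*[R+1] = identity R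
    where
    identity : ∀ R → suc (2 * R) + 1 ≡ 2 * suc R
    identity = solve-∀

  2d*[j*[P²+1]/2]≡[P²+1]*d*j : ∀ j d → 2 * d * (j * [P²+1]/2) ≡ (P² + 1) * d * j
  2d*[j*[P²+1]/2]≡[P²+1]*d*j = identity R
    where
    identity : ∀ R j d → 2 * d * (j * (2 * R * suc R + 1)) ≡ (suc (2 * R) * suc (2 * R) + 1) * d * j
    identity = solve-∀

  [P²+1]/2∣k : ∀ {d k} .{{_ : NonZero R}} → d ∣ suc R →
               P⁴-1 ∣ 2 * d * k * (P²-1 * P-1) → [P²+1]/2 ∣ k
  [P²+1]/2∣k {d} {k} d∣R+1 P⁴-1∣ =
    coprime-divisor (coprime-+1 {2 * R * suc R} (∣-trans d∣R+1 (n∣m*n (2 * R))))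
      (coprime-divisor (coprime-+1 {2 * R * suc R} {P-1} (m∣m*n (suc R)))
        (*-cancelˡ-∣ 2 (*-cancelˡ-∣ P²-1 {{P²-1≢0}} (≡.subst (P⁴-1 ∣_) (regroup P²-1 P-1 d k) P⁴-1∣))))
    where
    P²-1≢0 : NonZero P²-1
    P²-1≢0 = m*n≢0 (2 + 2 * R) (2 * R) {{_}} {{m*n≢0 2 R}}
    regroup : ∀ a b d k → 2 * d * k * (a * b) ≡ a * (2 * (b * (d * k)))
    regroup = solve-∀

^-double : ∀ m n → m ^ (2 * n) ≡ m ^ n * m ^ n
^-double m n = ≡.trans (≡.cong (λ k → m ^ (n + k)) (ℕₚ.+-identityʳ n)) (ℕₚ.^-distribˡ-+-* m n n)

module _ {c ℓ : Level} (F : CommutativeRing c ℓ) (isField : FieldDefs.IsField F) where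
  open CommutativeRing F using (_≈_; _≉_; setoid; sym; trans; 0#; 1#)
  open FieldDefs F
  open FieldProperties F isField
  open import Relation.Binary.Reasoning.Setoid setoid

  linDep⇒∈⟨g^[P²+1]d⟩ : ∀ R .{{_ : NonZero R}} {d k g x} → let open OddNumber R in
                        d ∣ suc R → HasCard (P² * P²) → IsPrimitiveRoot g →
                        x ≈ pow (pow g (2 * d)) k → LinDep P x (pow x P²) →
                        x ∈⟨ pow g ((P² + 1) * d) ⟩
  linDep⇒∈⟨g^[P²+1]d⟩ R {d} {k} {g} {x} d∣R+1 card g-primitive x≈g^[2d]^k linDep =
    j , (begin
      x                                 ≈⟨ x≈g^[2dk] ⟩
      pow g (2 * d * k)                 ≡⟨ ≡.cong (λ m → pow g (2 * d * m)) k≡j*[P²+1]/2 ⟩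
      pow g (2 * d * (j * [P²+1]/2))    ≡⟨ ≡.cong (pow g) (2d*[j*[P²+1]/2]≡[P²+1]*d*j j d) ⟩
      pow g ((P² + 1) * d * j)          ≈⟨ pow-assocʳ g ((P² + 1) * d) j ⟨
      pow (pow g ((P² + 1) * d)) j      ∎)
    where
    open OddNumber R
    open PrimitiveRoot (≡.subst HasCard P⁴≡1+P⁴-1 card) g-primitive using (order-∣)
    x≈g^[2dk] : x ≈ pow g (2 * d * k)
    x≈g^[2dk] = trans x≈g^[2d]^k (pow-assocʳ g (2 * d) k)
    x≉0 : x ≉ 0#
    x≉0 x≈0 = pow-≉0 (proj₁ g-primitive) (2 * d * k) (trans (sym x≈g^[2dk]) x≈0)
    x^[[P²-1]*[P-1]]≈1 : pow x (P²-1 * P-1) ≈ 1#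
    x^[[P²-1]*[P-1]]≈1 = pow-+-cancel (P² + P) (P²-1 * P-1) x≉0 (begin
      pow x (P² + P + P²-1 * P-1)    ≡⟨ ≡.cong (pow x) 1+P²*P≡P²+P+[P²-1]*[P-1] ⟨
      pow x (1 + P² * P)             ≈⟨ linDep⇒pow[1+QP]≈pow[Q+P] R P² x≉0 linDep ⟩
      pow x (P² + P)                 ∎)
    g^[2dk*[P²-1]*[P-1]]≈1 : pow g (2 * d * k * (P²-1 * P-1)) ≈ 1#
    g^[2dk*[P²-1]*[P-1]]≈1 = begin
      pow g (2 * d * k * (P²-1 * P-1))       ≈⟨ pow-assocʳ g (2 * d * k) (P²-1 * P-1) ⟨
      pow (pow g (2 * d * k)) (P²-1 * P-1)   ≈⟨ pow-congˡ (P²-1 * P-1) x≈g^[2dk] ⟨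
      pow x (P²-1 * P-1)                     ≈⟨ x^[[P²-1]*[P-1]]≈1 ⟩
      1#                                     ∎
    open _∣_ ([P²+1]/2∣k d∣R+1 (order-∣ _ g^[2dk*[P²-1]*[P-1]]≈1))
      renaming (quotient to j; equality to k≡j*[P²+1]/2)

lemma5p3 : ∀ {c ℓ : Level} (F : CommutativeRing c ℓ) →
    let open CommutativeRing F using (Carrier)
        open FieldDefs F
    in IsField →
       (p d t : ℕ) → Prime p → ¬ (2 ∣ p) → d ≥ 1 → t ≥ 1 →
       (2 * d) ∣ (p ^ t + 1) →
       HasCard (p ^ (4 * t)) →
       (g : Carrier) → IsPrimitiveRoot g →
       (x : Carrier) → x ∈⟨ pow g (2 * d) ⟩ →
       LinDep (p ^ t) x (pow x (p ^ (2 * t))) →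
       x ∈⟨ pow g ((p ^ (2 * t) + 1) * d) ⟩
lemma5p3 F isField p d t prime-p ¬2∣p _ t≥1 2d∣p^t+1 card g g-primitive x (k , x≈g^[2d]^k) linDep
  with odd-prime-power prime-p ¬2∣p t≥1
... | R , R≢0 , p^t≡P =
  ≡.subst (λ m → x ∈⟨ pow g ((m + 1) * d) ⟩) (≡.sym p^2t≡P²)
    (linDep⇒∈⟨g^[P²+1]d⟩ F isField R {{R≢0}} {k = k} d∣R+1 (≡.subst HasCard p^4t≡P²*P² card) g-primitive x≈g^[2d]^k
      (≡.subst₂ (λ m e → LinDep m x (pow x e)) p^t≡P p^2t≡P² linDep))
  where
  open FieldDefs F
  open OddNumber R
  p^2t≡P² : p ^ (2 * t) ≡ P²
  p^2t≡P² = ≡.trans (^-double p t) (≡.cong₂ _*_ p^t≡P p^t≡P)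
  p^4t≡P²*P² : p ^ (4 * t) ≡ P² * P²
  p^4t≡P²*P² = ≡.trans (≡.cong (p ^_) (ℕₚ.*-assoc 2 2 t)) (≡.trans (^-double p (2 * t)) (≡.cong₂ _*_ p^2t≡P² p^2t≡P²))
  d∣R+1 : d ∣ suc R
  d∣R+1 = *-cancelˡ-∣ 2 (≡.subst (2 * d ∣_) (≡.trans (≡.cong (_+ 1) p^t≡P) P+1≡2*[R+1]) 2d∣p^t+1)
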